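{- The pattern sets $\{123,132,231,312\}$ and $\{132,213,231,312\}$ are extendably Wilf-equivalent. That is, $|\mathcal S_{d,c,r}(123,132,231,312)|=|\mathcal S_{d,c,r}(132,213,231,312)|$ for all $d,c,r\ge0$.
   Context: The permutation matrix of $\sigma\in\mathcal S_n$ is the $n\times n$ $0$-$1$ matrix with a $1$ in position $(i,\sigma(i))$. A partial permutation is a rectangular $0$-$1$ matrix with at most one $1$ ("dot") in each row and column. $\mathcal S_{d,c,r}$ is the set of partial permutations with $d$ dots, $r$ empty rows and $c$ empty columns, so they have size $(d+r)\times(d+c)$. A permutation $\sigma\in\mathcal S_{d+c+r}$ extends $\rho$ if $\rho$ is the upper-left $(d+r)\times(d+c)$ submatrix of $\sigma$'s permutation matrix. $\sigma$ contains $\pi\in\mathcal S_m$ if the permutation matrix of $\pi$ is a submatrix of that of $\sigma$. For a set $\tau$ of patterns, $\mathcal S_{d,c,r}(\tau)$ is the set of $\rho\in\mathcal S_{d,c,r}$ having an extension that avoids all patterns in $\tau$. -}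

module Defs where

open import Data.Nat using (ℕ; suc; _+_; _<_)
open import Data.Fin using (Fin; toℕ; zero) renaming (suc to fsuc)
open import Data.Maybe using (Maybe; just; nothing)
open import Data.Vec using (Vec; lookup; []; _∷_)
open import Data.List using (List; length)
open import Data.List.Relation.Unary.All using (All)
open import Data.List.Relation.Unary.Unique.Propositional using (Unique)
open import Data.List.Membership.Propositional using (_∈_)
open import Data.Product using (Σ; ∃; _×_; _,_; proj₂)
open import Function.Bundles using (_⇔_)
open import Function.Definitions using (Injective)
open import Relation.Binary.PropositionalEquality using (_≡_; refl)
open import Relation.Nullary using (¬_)

-- A permutation of [n] in one-line notation: an injective map Fin n → Fin n
-- (σ i is the column of the 1 in row i of the permutation matrix).
record Perm (n : ℕ) : Set where
  constructor perm
  field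
    fun : Fin n → Fin n
    inj : Injective _≡_ _≡_ fun
open Perm public

StrictlyIncreasing : {m n : ℕ} → (Fin m → Fin n) → Set
StrictlyIncreasing {m} f = ∀ (a b : Fin m) → toℕ a < toℕ b → toℕ (f a) < toℕ (f b)

-- σ contains the pattern π: the permutation matrix of π is a submatrix of
-- that of σ (rows f, columns g).
Contains : {n m : ℕ} → Perm n → Perm m → Set
Contains {n} {m} σ π =
  Σ (Fin m → Fin n) λ f → Σ (Fin m → Fin n) λ g →
    StrictlyIncreasing f × StrictlyIncreasing g ×
    (∀ (a b : Fin m) → (fun σ (f a) ≡ g b) ⇔ (fun π a ≡ b))

Avoids : {n m : ℕ} → Perm n → Perm m → Set
Avoids σ π = ¬ Contains σ π

Pattern : Set
Pattern = Σ ℕ Perm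

AvoidsAll : {n : ℕ} → Perm n → List Pattern → Set
AvoidsAll σ τ = All (λ p → Avoids σ (proj₂ p)) τ

-- Partial permutation with (rows) × (cols) shape: row i holds a dot in column j
-- iff the entry is just j.  At most one dot per row is built in.
PMat : ℕ → ℕ → Set
PMat rows cols = Vec (Maybe (Fin cols)) rows

dots : {rows cols : ℕ} → PMat rows cols → ℕ
dots [] = 0
dots (nothing ∷ ρ) = dots ρ
dots (just _ ∷ ρ) = suc (dots ρ)

ColInjective : {rows cols : ℕ} → PMat rows cols → Set
ColInjective {rows} ρ = ∀ (i i' : Fin rows) j → lookup ρ i ≡ just j → lookup ρ i' ≡ just j → i ≡ i'

-- ρ ∈ S_{d,c,r}: (d+r)×(d+c) partial permutation with d dots
-- (hence r empty rows and c empty columns).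
IsPartialPerm : (d c r : ℕ) → PMat (d + r) (d + c) → Set
IsPartialPerm d c r ρ = ColInjective ρ × dots ρ ≡ d

-- σ ∈ S_{d+c+r} extends ρ: ρ is the upper-left (d+r)×(d+c) submatrix of σ.
Extends : (d c r : ℕ) → Perm (d + c + r) → PMat (d + r) (d + c) → Set
Extends d c r σ ρ =
  ∀ (i : Fin (d + r)) (j : Fin (d + c)) (i' j' : Fin (d + c + r)) →
    toℕ i ≡ toℕ i' → toℕ j ≡ toℕ j' → (lookup ρ i ≡ just j) ⇔ (fun σ i' ≡ j')

InS : (τ : List Pattern) (d c r : ℕ) → PMat (d + r) (d + c) → Set
InS τ d c r ρ = IsPartialPerm d c r ρ × ∃ λ σ → Extends d c r σ ρ × AvoidsAll σ τ

HasSize : {A : Set} → (A → Set) → ℕ → Set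
HasSize {A} P k = Σ (List A) λ L →
  length L ≡ k × Unique L × All P L × (∀ x → P x → x ∈ L)

-- Patterns in one-line notation (values 1,2,3 written as Fin 3 values 0,1,2).

f123 : Fin 3 → Fin 3
f123 zero = zero
f123 (fsuc zero) = (fsuc zero)
f123 (fsuc (fsuc zero)) = (fsuc (fsuc zero))

inj123 : Injective _≡_ _≡_ f123
inj123 {zero} {zero} refl = refl
inj123 {zero} {(fsuc zero)} ()
inj123 {zero} {(fsuc (fsuc zero))} ()
inj123 {(fsuc zero)} {zero} ()
inj123 {(fsuc zero)} {(fsuc zero)} refl = refl
inj123 {(fsuc zero)} {(fsuc (fsuc zero))} ()
inj123 {(fsuc (fsuc zero))} {zero} ()
inj123 {(fsuc (fsuc zero))} {(fsuc zero)} ()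
inj123 {(fsuc (fsuc zero))} {(fsuc (fsuc zero))} refl = refl

p123 : Pattern
p123 = 3 , perm f123 inj123

f132 : Fin 3 → Fin 3
f132 zero = zero
f132 (fsuc zero) = (fsuc (fsuc zero))
f132 (fsuc (fsuc zero)) = (fsuc zero)

inj132 : Injective _≡_ _≡_ f132
inj132 {zero} {zero} refl = refl
inj132 {zero} {(fsuc zero)} ()
inj132 {zero} {(fsuc (fsuc zero))} ()
inj132 {(fsuc zero)} {zero} ()
inj132 {(fsuc zero)} {(fsuc zero)} refl = refl
inj132 {(fsuc zero)} {(fsuc (fsuc zero))} ()
inj132 {(fsuc (fsuc zero))} {zero} ()
inj132 {(fsuc (fsuc zero))} {(fsuc zero)} ()
inj132 {(fsuc (fsuc zero))} {(fsuc (fsuc zero))} refl = refl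

p132 : Pattern
p132 = 3 , perm f132 inj132

f231 : Fin 3 → Fin 3
f231 zero = (fsuc zero)
f231 (fsuc zero) = (fsuc (fsuc zero))
f231 (fsuc (fsuc zero)) = zero

inj231 : Injective _≡_ _≡_ f231
inj231 {zero} {zero} refl = refl
inj231 {zero} {(fsuc zero)} ()
inj231 {zero} {(fsuc (fsuc zero))} ()
inj231 {(fsuc zero)} {zero} ()
inj231 {(fsuc zero)} {(fsuc zero)} refl = refl
inj231 {(fsuc zero)} {(fsuc (fsuc zero))} ()
inj231 {(fsuc (fsuc zero))} {zero} ()
inj231 {(fsuc (fsuc zero))} {(fsuc zero)} ()
inj231 {(fsuc (fsuc zero))} {(fsuc (fsuc zero))} refl = refl

p231 : Pattern
p231 = 3 , perm f231 inj231

f312 : Fin 3 → Fin 3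
f312 zero = (fsuc (fsuc zero))
f312 (fsuc zero) = zero
f312 (fsuc (fsuc zero)) = (fsuc zero)

inj312 : Injective _≡_ _≡_ f312
inj312 {zero} {zero} refl = refl
inj312 {zero} {(fsuc zero)} ()
inj312 {zero} {(fsuc (fsuc zero))} ()
inj312 {(fsuc zero)} {zero} ()
inj312 {(fsuc zero)} {(fsuc zero)} refl = refl
inj312 {(fsuc zero)} {(fsuc (fsuc zero))} ()
inj312 {(fsuc (fsuc zero))} {zero} ()
inj312 {(fsuc (fsuc zero))} {(fsuc zero)} ()
inj312 {(fsuc (fsuc zero))} {(fsuc (fsuc zero))} refl = refl

p312 : Pattern
p312 = 3 , perm f312 inj312

f213 : Fin 3 → Fin 3
f213 zero = (fsuc zero)
f213 (fsuc zero) = zero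
f213 (fsuc (fsuc zero)) = (fsuc (fsuc zero))

inj213 : Injective _≡_ _≡_ f213
inj213 {zero} {zero} refl = refl
inj213 {zero} {(fsuc zero)} ()
inj213 {zero} {(fsuc (fsuc zero))} ()
inj213 {(fsuc zero)} {zero} ()
inj213 {(fsuc zero)} {(fsuc zero)} refl = refl
inj213 {(fsuc zero)} {(fsuc (fsuc zero))} ()
inj213 {(fsuc (fsuc zero))} {zero} ()
inj213 {(fsuc (fsuc zero))} {(fsuc zero)} ()
inj213 {(fsuc (fsuc zero))} {(fsuc (fsuc zero))} refl = refl

p213 : Pattern
p213 = 3 , perm f213 inj213

-- A permutation avoiding 123, 132, 231 and 312 has only triples of shape 213 or 321, which
-- forces it to be the reversal n … 2 1 or (n-1) … 2 1 n; avoiding 132, 213, 231 and 312 makes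
-- every triple monotone, which forces the identity or the reversal.  A partial permutation is
-- the upper-left corner of each of its extensions, so each S_{d,c,r}(τ) consists of the corner
-- of the reversal, which always has exactly d dots, and possibly the corner of the second
-- permutation.  For the identity as for (n-1) … 2 1 n, that corner has d dots exactly when
-- r = 0 or c = 0, and then differs from the corner of the reversal exactly when d ≥ 1 and
-- n ≥ 2.  So both sets have the same size.

module Submission where

open import Defs
open import Data.Bool using (if_then_else_)
open import Data.Empty using (⊥; ⊥-elim)
open import Data.Fin using (Fin; toℕ; fromℕ<; inject≤; zero; #_) renaming (suc to fsuc)
open import Data.Fin.Properties using (toℕ-injective; toℕ<n; toℕ-fromℕ<; fromℕ<-toℕ; toℕ-inject≤)
import Data.Fin.Properties as Fin
open import Data.List using (List; _∷_; [])
open import Data.List.Relation.Unary.All using (_∷_; [])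
open import Data.List.Relation.Unary.AllPairs using (_∷_; [])
open import Data.List.Membership.Propositional using (_∈_)
open import Data.List.Relation.Unary.Any using (here; there)
open import Data.Maybe using (Maybe; just; nothing)
import Data.Maybe.Properties as Maybe
open import Data.Nat
open import Data.Nat.Properties
open import Data.Product using (∃; _×_; _,_; proj₁; proj₂)
open import Data.Sum using (_⊎_; inj₁; inj₂; swap)
import Data.Sum as Sum
open import Data.Vec using (lookup; tabulate; []; _∷_)
open import Data.Vec.Properties using (lookup∘tabulate; tabulate∘lookup; tabulate-cong)
import Data.Vec.Properties as Vec
open import Function using (_∘_; flip)
open import Function.Bundles using (_⇔_; mk⇔; Equivalence)
open import Function.Definitions using (Injective)
open import Relation.Binary.Definitions using (DecidableEquality; Transitive; Asymmetric; tri<; tri≈; tri>)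
open import Relation.Binary.PropositionalEquality
open import Relation.Nullary using (¬_; Dec; yes; no; does)
open import Relation.Nullary.Decidable using (_×-dec_; _⊎-dec_)
import Relation.Nullary.Decidable as Dec

-- Permutations as functions on ℕ

MapsBelow : ℕ → (ℕ → ℕ) → Set
MapsBelow n h = ∀ {x} → x < n → h x < n

InjectiveBelow : ℕ → (ℕ → ℕ) → Set
InjectiveBelow n h = ∀ {x y} → x < n → y < n → h x ≡ h y → x ≡ y

AgreeBelow : ℕ → (ℕ → ℕ) → (ℕ → ℕ) → Set
AgreeBelow n g h = ∀ {x} → x < n → g x ≡ h x

≤1⇒agreeBelow : ∀ {n g h} → n ≤ 1 → MapsBelow n g → MapsBelow n h → AgreeBelow n g h
≤1⇒agreeBelow n≤1 g-below h-below x<n =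
  trans (n<1⇒n≡0 (<-≤-trans (g-below x<n) n≤1)) (sym (n<1⇒n≡0 (<-≤-trans (h-below x<n) n≤1)))

-- Values at x ≥ n are junk (0); every lemma below only looks at x < n.
⟦_⟧ : {n : ℕ} → Perm n → ℕ → ℕ
⟦_⟧ {n} σ x with x <? n
... | yes x<n = toℕ (fun σ (fromℕ< x<n))
... | no _ = 0

⟦⟧-fromℕ< : {n : ℕ} (σ : Perm n) {x : ℕ} (x<n : x < n) → ⟦ σ ⟧ x ≡ toℕ (fun σ (fromℕ< x<n))
⟦⟧-fromℕ< {n} σ {x} x<n with x <? n
... | yes _ = refl
... | no x≮n = ⊥-elim (x≮n x<n)

⟦⟧-toℕ : {n : ℕ} (σ : Perm n) (i : Fin n) → ⟦ σ ⟧ (toℕ i) ≡ toℕ (fun σ i)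
⟦⟧-toℕ σ i = trans (⟦⟧-fromℕ< σ (toℕ<n i)) (cong (toℕ ∘ fun σ) (fromℕ<-toℕ i (toℕ<n i)))

⟦⟧-mapsBelow : {n : ℕ} (σ : Perm n) → MapsBelow n ⟦ σ ⟧
⟦⟧-mapsBelow σ x<n rewrite ⟦⟧-fromℕ< σ x<n = toℕ<n _

⟦⟧-injectiveBelow : {n : ℕ} (σ : Perm n) → InjectiveBelow n ⟦ σ ⟧
⟦⟧-injectiveBelow σ x<n y<n eq rewrite ⟦⟧-fromℕ< σ x<n | ⟦⟧-fromℕ< σ y<n =
  trans (sym (toℕ-fromℕ< x<n)) (trans (cong toℕ (inj σ (toℕ-injective eq))) (toℕ-fromℕ< y<n))

permOf : (n : ℕ) (h : ℕ → ℕ) → MapsBelow n h → InjectiveBelow n h → Perm n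
permOf n h below injective = perm (λ i → fromℕ< (below (toℕ<n i))) λ {i} {j} eq →
  toℕ-injective (injective (toℕ<n i) (toℕ<n j)
    (trans (sym (toℕ-fromℕ< (below (toℕ<n i)))) (trans (cong toℕ eq) (toℕ-fromℕ< (below (toℕ<n j))))))

⟦⟧-permOf : ∀ n h (below : MapsBelow n h) (injective : InjectiveBelow n h) →
  AgreeBelow n ⟦ permOf n h below injective ⟧ h
⟦⟧-permOf n h below injective x<n =
  trans (⟦⟧-fromℕ< (permOf n h below injective) x<n)
        (trans (toℕ-fromℕ< (below (toℕ<n _))) (cong h (toℕ-fromℕ< x<n)))

StrictlyIncreasing⇒injective : {m n : ℕ} (f : Fin m → Fin n) → StrictlyIncreasing f → Injective _≡_ _≡_ f
StrictlyIncreasing⇒injective f increasing {a} {b} eq with <-cmp (toℕ a) (toℕ b)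
... | tri< a<b _ _ = ⊥-elim (<-irrefl (cong toℕ eq) (increasing a b a<b))
... | tri≈ _ a≡b _ = toℕ-injective a≡b
... | tri> _ _ b<a = ⊥-elim (<-irrefl (cong toℕ (sym eq)) (increasing b a b<a))

OccursAt : {n m : ℕ} → Perm n → Perm m → (Fin m → Fin n) → Set
OccursAt σ π f = StrictlyIncreasing f ×
  (∀ a b → toℕ (fun π a) < toℕ (fun π b) → ⟦ σ ⟧ (toℕ (f a)) < ⟦ σ ⟧ (toℕ (f b)))

contains⇒occurs : {n m : ℕ} (σ : Perm n) (π : Perm m) → Contains σ π → ∃ (OccursAt σ π)
contains⇒occurs σ π (f , g , f↑ , g↑ , matrix) = f , f↑ , λ a b πa<πb →
  subst₂ _<_ (sym (image a)) (sym (image b)) (g↑ _ _ πa<πb)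
  where
  image : ∀ a → ⟦ σ ⟧ (toℕ (f a)) ≡ toℕ (g (fun π a))
  image a = trans (⟦⟧-toℕ σ (f a)) (cong toℕ (Equivalence.from (matrix a (fun π a)) refl))

record InverseOf {m : ℕ} (π : Perm m) : Set where
  field
    inv : Fin m → Fin m
    fun-inv : ∀ b → fun π (inv b) ≡ b
    inv-fun : ∀ a → inv (fun π a) ≡ a
open InverseOf

occurs⇒contains : {n m : ℕ} (σ : Perm n) (π : Perm m) → InverseOf π →
  (f : Fin m → Fin n) → OccursAt σ π f → Contains σ π
occurs⇒contains σ π ι f (f↑ , order) = f , g , f↑ , g↑ , λ a b → mk⇔ (to a b) (from a b)
  where
  g : Fin _ → Fin _
  g b = fun σ (f (inv ι b))
  g↑ : StrictlyIncreasing g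
  g↑ b b' b<b' = subst₂ _<_ (⟦⟧-toℕ σ (f (inv ι b))) (⟦⟧-toℕ σ (f (inv ι b')))
    (order _ _ (subst₂ (λ u v → toℕ u < toℕ v) (sym (fun-inv ι b)) (sym (fun-inv ι b')) b<b'))
  to : ∀ a b → fun σ (f a) ≡ g b → fun π a ≡ b
  to a b eq = trans (cong (fun π) (StrictlyIncreasing⇒injective f f↑ (inj σ eq))) (fun-inv ι b)
  from : ∀ a b → fun π a ≡ b → fun σ (f a) ≡ g b
  from a _ refl = cong (fun σ ∘ f) (sym (inv-fun ι a))

∀-Fin3 : {P : Fin 3 → Set} → P zero → P (fsuc zero) → P (fsuc (fsuc zero)) → ∀ a → P a
∀-Fin3 p₀ p₁ p₂ zero = p₀
∀-Fin3 p₀ p₁ p₂ (fsuc zero) = p₁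
∀-Fin3 p₀ p₁ p₂ (fsuc (fsuc zero)) = p₂

triple : ℕ → ℕ → ℕ → Fin 3 → ℕ
triple x y z zero = x
triple x y z (fsuc zero) = y
triple x y z (fsuc (fsuc zero)) = z

increasing-Fin3 : (W : Fin 3 → ℕ) → W zero < W (fsuc zero) → W (fsuc zero) < W (fsuc (fsuc zero)) →
  ∀ a b → toℕ a < toℕ b → W a < W b
increasing-Fin3 W w₀₁ w₁₂ zero (fsuc zero) _ = w₀₁
increasing-Fin3 W w₀₁ w₁₂ zero (fsuc (fsuc zero)) _ = <-trans w₀₁ w₁₂
increasing-Fin3 W w₀₁ w₁₂ (fsuc zero) (fsuc (fsuc zero)) _ = w₁₂
increasing-Fin3 W w₀₁ w₁₂ (fsuc zero) (fsuc zero) (s≤s ())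
increasing-Fin3 W w₀₁ w₁₂ (fsuc (fsuc zero)) (fsuc (fsuc zero)) (s≤s (s≤s ()))
increasing-Fin3 W w₀₁ w₁₂ (fsuc (fsuc zero)) (fsuc zero) (s≤s ())

-- The restriction of σ to positions x < y < z is order-isomorphic to π:
-- read in the order π⁻¹, its values increase.
PatternAt : {n : ℕ} (σ : Perm n) {π : Perm 3} → InverseOf π → ℕ → ℕ → ℕ → Set
PatternAt σ ι x y z =
  V (inv ι zero) < V (inv ι (fsuc zero)) × V (inv ι (fsuc zero)) < V (inv ι (fsuc (fsuc zero)))
  where
  V : Fin 3 → ℕ
  V = ⟦ σ ⟧ ∘ triple x y z

avoids⇒¬patternAt : {n : ℕ} (σ : Perm n) {π : Perm 3} (ι : InverseOf π) → Avoids σ π →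
  ∀ {x y z} → x < y → y < z → z < n → ¬ PatternAt σ ι x y z
avoids⇒¬patternAt {n} σ {π} ι avoids {x} {y} {z} x<y y<z z<n (v₀₁ , v₁₂) =
  avoids (occurs⇒contains σ π ι f (f↑ , order))
  where
  t : Fin 3 → ℕ
  t = triple x y z
  t<n : ∀ a → t a < n
  t<n = ∀-Fin3 (<-trans x<y (<-trans y<z z<n)) (<-trans y<z z<n) z<n
  f : Fin 3 → Fin n
  f a = fromℕ< (t<n a)
  toℕ-f : ∀ a → toℕ (f a) ≡ t a
  toℕ-f a = toℕ-fromℕ< (t<n a)
  f↑ : StrictlyIncreasing f
  f↑ a b a<b = subst₂ _<_ (sym (toℕ-f a)) (sym (toℕ-f b)) (increasing-Fin3 t x<y y<z a b a<b)
  order : ∀ a b → toℕ (fun π a) < toℕ (fun π b) → ⟦ σ ⟧ (toℕ (f a)) < ⟦ σ ⟧ (toℕ (f b))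
  order a b πa<πb = subst₂ (λ u v → ⟦ σ ⟧ u < ⟦ σ ⟧ v) (sym (toℕ-f a)) (sym (toℕ-f b))
    (subst₂ (λ u v → ⟦ σ ⟧ (t u) < ⟦ σ ⟧ (t v)) (inv-fun ι a) (inv-fun ι b)
      (increasing-Fin3 (⟦ σ ⟧ ∘ t ∘ inv ι) v₀₁ v₁₂ (fun π a) (fun π b) πa<πb))

involution⇒inverse : {π : Perm 3} → (∀ a → fun π (fun π a) ≡ a) → InverseOf π
involution⇒inverse {π} πeπ = record { inv = fun π ; fun-inv = πeπ ; inv-fun = πeπ }

inverse123 : InverseOf (proj₂ p123)
inverse123 = involution⇒inverse (∀-Fin3 refl refl refl)

inverse132 : InverseOf (proj₂ p132)
inverse132 = involution⇒inverse (∀-Fin3 refl refl refl)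

inverse213 : InverseOf (proj₂ p213)
inverse213 = involution⇒inverse (∀-Fin3 refl refl refl)

inverse231 : InverseOf (proj₂ p231)
inverse231 = record { inv = f312 ; fun-inv = ∀-Fin3 refl refl refl ; inv-fun = ∀-Fin3 refl refl refl }

inverse312 : InverseOf (proj₂ p312)
inverse312 = record { inv = f231 ; fun-inv = ∀-Fin3 refl refl refl ; inv-fun = ∀-Fin3 refl refl refl }

-- The identity, the reversal, and the reversal of all but the last point

reverseℕ : ℕ → ℕ → ℕ
reverseℕ n x = n ∸ suc x

reverseℕ-mapsBelow : ∀ n → MapsBelow n (reverseℕ n)
reverseℕ-mapsBelow n x<n = ∸-monoʳ-< z<s x<n

reverseℕ-antitone : ∀ {n x y} → x < y → y < n → reverseℕ n y < reverseℕ n x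
reverseℕ-antitone x<y y<n = ∸-monoʳ-< (s≤s x<y) y<n

reverseℕ-injectiveBelow : ∀ n → InjectiveBelow n (reverseℕ n)
reverseℕ-injectiveBelow n x<n y<n eq = suc-injective (∸-cancelˡ-≡ x<n y<n eq)

reverseℕ-involutive : ∀ {n x} → x < n → reverseℕ n (reverseℕ n x) ≡ x
reverseℕ-involutive {suc n} (s≤s x≤n) = m∸[m∸n]≡n x≤n

-- In one-line notation, (n-1) … 2 1 n.
reverseInitℕ : ℕ → ℕ → ℕ
reverseInitℕ n x with suc x <? n
... | yes _ = reverseℕ (pred n) x
... | no _ = x

reverseInitℕ-init : ∀ {n x} → suc x < n → reverseInitℕ n x ≡ reverseℕ (pred n) x
reverseInitℕ-init {n} {x} sx<n with suc x <? n
... | yes _ = refl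
... | no sx≮n = ⊥-elim (sx≮n sx<n)

reverseInitℕ-last : ∀ {n x} → ¬ suc x < n → reverseInitℕ n x ≡ x
reverseInitℕ-last {n} {x} sx≮n with suc x <? n
... | yes sx<n = ⊥-elim (sx≮n sx<n)
... | no _ = refl

reverseInitℕ-mapsBelow : ∀ n → MapsBelow n (reverseInitℕ n)
reverseInitℕ-mapsBelow n {x} x<n with suc x <? n
... | yes sx<n = <-≤-trans (reverseℕ-mapsBelow (pred n) (<⇒≤pred sx<n)) pred[n]≤n
... | no _ = x<n

reverseInitℕ-injectiveBelow : ∀ n → InjectiveBelow n (reverseInitℕ n)
reverseInitℕ-injectiveBelow n {x} {y} x<n y<n eq with suc x <? n | suc y <? n
... | yes sx<n | yes sy<n = reverseℕ-injectiveBelow (pred n) (<⇒≤pred sx<n) (<⇒≤pred sy<n) eq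
... | yes sx<n | no sy≮n = ⊥-elim (<-irrefl eq
      (<-≤-trans (reverseℕ-mapsBelow (pred n) (<⇒≤pred sx<n)) (pred-mono-≤ (≮⇒≥ sy≮n))))
... | no sx≮n | yes sy<n = ⊥-elim (<-irrefl (sym eq)
      (<-≤-trans (reverseℕ-mapsBelow (pred n) (<⇒≤pred sy<n)) (pred-mono-≤ (≮⇒≥ sx≮n))))
... | no _ | no _ = eq

reverseInitℕ-ascent⇒last : ∀ {n x y} → x < y → reverseInitℕ n x < reverseInitℕ n y → ¬ suc y < n
reverseInitℕ-ascent⇒last {n} {x} x<y ascent sy<n = <-asym ascent
  (subst₂ _<_ (sym (reverseInitℕ-init sy<n)) (sym (reverseInitℕ-init (<-trans (s≤s x<y) sy<n)))
    (reverseℕ-antitone x<y (<⇒≤pred sy<n)))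

reverseℕ-<⇔ : ∀ a b {x} → x < a + b → (reverseℕ (a + b) x < a) ⇔ (b ≤ x)
reverseℕ-<⇔ a b {x} x<n = mk⇔
  (λ rev<a → s≤s⁻¹ (∸-cancelʳ-< (subst (reverseℕ (a + b) x <_) (sym (m+n∸n≡m a b)) rev<a)))
  (λ b≤x → subst (reverseℕ (a + b) x <_) (m+n∸n≡m a b) (∸-monoʳ-< (s≤s b≤x) x<n))

reverseInitℕ-<⇔ : ∀ a b {x} → x < a + b → (reverseInitℕ (a + suc b) x < a) ⇔ (b ≤ x)
reverseInitℕ-<⇔ a b {x} x<n =
  subst (λ v → (v < a) ⇔ (b ≤ x)) (sym value) (reverseℕ-<⇔ a b x<n)
  where
  sx<N : suc x < a + suc b
  sx<N = subst (suc x <_) (sym (+-suc a b)) (s≤s x<n)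
  value : reverseInitℕ (a + suc b) x ≡ reverseℕ (a + b) x
  value = trans (reverseInitℕ-init sx<N) (cong (λ m → reverseℕ (pred m) x) (+-suc a b))

reverseInitℕ<reverseℕ : ∀ {n x} → suc x < n → reverseInitℕ n x < reverseℕ n x
reverseInitℕ<reverseℕ {suc n} {x} sx<n = subst (_< reverseℕ (suc n) x) (sym (reverseInitℕ-init sx<n))
  (∸-monoʳ-< (n<1+n (suc x)) sx<n)

identity : (n : ℕ) → Perm n
identity n = permOf n (λ x → x) (λ x<n → x<n) (λ _ _ eq → eq)

reversal : (n : ℕ) → Perm n
reversal n = permOf n (reverseℕ n) (reverseℕ-mapsBelow n) (reverseℕ-injectiveBelow n)

reverseInit : (n : ℕ) → Perm n
reverseInit n = permOf n (reverseInitℕ n) (reverseInitℕ-mapsBelow n) (reverseInitℕ-injectiveBelow n)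

⟦identity⟧ : ∀ n → AgreeBelow n ⟦ identity n ⟧ (λ x → x)
⟦identity⟧ n = ⟦⟧-permOf n (λ x → x) (λ x<n → x<n) (λ _ _ eq → eq)

⟦reversal⟧ : ∀ n → AgreeBelow n ⟦ reversal n ⟧ (reverseℕ n)
⟦reversal⟧ n = ⟦⟧-permOf n (reverseℕ n) (reverseℕ-mapsBelow n) (reverseℕ-injectiveBelow n)

⟦reverseInit⟧ : ∀ n → AgreeBelow n ⟦ reverseInit n ⟧ (reverseInitℕ n)
⟦reverseInit⟧ n = ⟦⟧-permOf n (reverseInitℕ n) (reverseInitℕ-mapsBelow n) (reverseInitℕ-injectiveBelow n)

identity-avoids : ∀ n {m} (π : Perm m) (a b : Fin m) →
  toℕ a < toℕ b → toℕ (fun π b) < toℕ (fun π a) → Avoids (identity n) π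
identity-avoids n π a b a<b descent contains with contains⇒occurs (identity n) π contains
... | f , f↑ , order = <-asym (f↑ a b a<b)
  (subst₂ _<_ (value b) (value a) (order b a descent))
  where
  value : ∀ a → ⟦ identity n ⟧ (toℕ (f a)) ≡ toℕ (f a)
  value a = ⟦identity⟧ n (toℕ<n (f a))

reversal-avoids : ∀ n {m} (π : Perm m) (a b : Fin m) →
  toℕ a < toℕ b → toℕ (fun π a) < toℕ (fun π b) → Avoids (reversal n) π
reversal-avoids n π a b a<b ascent contains with contains⇒occurs (reversal n) π contains
... | f , f↑ , order = <-asym (reverseℕ-antitone (f↑ a b a<b) (toℕ<n (f b)))
  (subst₂ _<_ (value a) (value b) (order a b ascent))
  where
  value : ∀ a → ⟦ reversal n ⟧ (toℕ (f a)) ≡ reverseℕ n (toℕ (f a))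
  value a = ⟦reversal⟧ n (toℕ<n (f a))

-- The ascent forces f b to be the last position n - 1, whose value n - 1 is maximal.
reverseInit-avoids : ∀ n {m} (π : Perm m) (a b c : Fin m) →
  toℕ a < toℕ b → toℕ (fun π a) < toℕ (fun π b) →
  toℕ b < toℕ c ⊎ toℕ (fun π b) < toℕ (fun π c) →
  Avoids (reverseInit n) π
reverseInit-avoids n π a b c a<b ascent b-not-last contains
  with contains⇒occurs (reverseInit n) π contains
... | f , f↑ , order = contradiction b-not-last
  where
  value : ∀ a → ⟦ reverseInit n ⟧ (toℕ (f a)) ≡ reverseInitℕ n (toℕ (f a))
  value a = ⟦reverseInit⟧ n (toℕ<n (f a))
  last : ¬ suc (toℕ (f b)) < n
  last = reverseInitℕ-ascent⇒last (f↑ a b a<b) (subst₂ _<_ (value a) (value b) (order a b ascent))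
  contradiction : toℕ b < toℕ c ⊎ toℕ (fun π b) < toℕ (fun π c) → ⊥
  contradiction (inj₁ b<c) = last (<-≤-trans (s≤s (f↑ b c b<c)) (toℕ<n (f c)))
  contradiction (inj₂ πb<πc) = last (≤-<-trans
    (subst (_< ⟦ reverseInit n ⟧ (toℕ (f c))) (trans (value b) (reverseInitℕ-last last)) (order b c πb<πc))
    (⟦⟧-mapsBelow (reverseInit n) (toℕ<n (f c))))

τ₁ τ₂ : List Pattern
τ₁ = p123 ∷ p132 ∷ p231 ∷ p312 ∷ []
τ₂ = p132 ∷ p213 ∷ p231 ∷ p312 ∷ []

reversal-avoids-τ₁ : ∀ n → AvoidsAll (reversal n) τ₁
reversal-avoids-τ₁ n =
  reversal-avoids n (proj₂ p123) (# 0) (# 1) z<s z<s ∷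
  reversal-avoids n (proj₂ p132) (# 0) (# 1) z<s z<s ∷
  reversal-avoids n (proj₂ p231) (# 0) (# 1) z<s (s<s z<s) ∷
  reversal-avoids n (proj₂ p312) (# 1) (# 2) (s<s z<s) z<s ∷ []

reversal-avoids-τ₂ : ∀ n → AvoidsAll (reversal n) τ₂
reversal-avoids-τ₂ n =
  reversal-avoids n (proj₂ p132) (# 0) (# 1) z<s z<s ∷
  reversal-avoids n (proj₂ p213) (# 1) (# 2) (s<s z<s) z<s ∷
  reversal-avoids n (proj₂ p231) (# 0) (# 1) z<s (s<s z<s) ∷
  reversal-avoids n (proj₂ p312) (# 1) (# 2) (s<s z<s) z<s ∷ []

reverseInit-avoids-τ₁ : ∀ n → AvoidsAll (reverseInit n) τ₁
reverseInit-avoids-τ₁ n =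
  reverseInit-avoids n (proj₂ p123) (# 0) (# 1) (# 2) z<s z<s (inj₁ (s<s z<s)) ∷
  reverseInit-avoids n (proj₂ p132) (# 0) (# 1) (# 2) z<s z<s (inj₁ (s<s z<s)) ∷
  reverseInit-avoids n (proj₂ p231) (# 0) (# 1) (# 2) z<s (s<s z<s) (inj₁ (s<s z<s)) ∷
  reverseInit-avoids n (proj₂ p312) (# 1) (# 2) (# 0) (s<s z<s) z<s (inj₂ (s<s z<s)) ∷ []

identity-avoids-τ₂ : ∀ n → AvoidsAll (identity n) τ₂
identity-avoids-τ₂ n =
  identity-avoids n (proj₂ p132) (# 1) (# 2) (s<s z<s) (s<s z<s) ∷
  identity-avoids n (proj₂ p213) (# 0) (# 1) z<s z<s ∷
  identity-avoids n (proj₂ p231) (# 1) (# 2) (s<s z<s) z<s ∷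
  identity-avoids n (proj₂ p312) (# 0) (# 1) z<s z<s ∷ []

-- The avoiders of τ₁ and of τ₂

IncreasingBelow DecreasingBelow : ℕ → (ℕ → ℕ) → Set
IncreasingBelow n V = ∀ {x y} → x < y → y < n → V x < V y
DecreasingBelow n V = ∀ {x y} → x < y → y < n → V y < V x

increasing⇒identity : ∀ {n V} → MapsBelow n V → IncreasingBelow n V → AgreeBelow n V (λ x → x)
increasing⇒identity {n} {V} below increasing {x} x<n =
  ≤-antisym (s≤s⁻¹ (+-cancelʳ-< k (V x) (suc x) Vx+k<sx+k)) (above x x<n)
  where
  above : ∀ x → x < n → x ≤ V x
  above zero _ = z≤n
  above (suc x) sx<n = ≤-<-trans (above x (<-trans (n<1+n x) sx<n)) (increasing (n<1+n x) sx<n)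
  shifted : ∀ k {x} → x + k < n → V x + k < n
  shifted zero {x} x+0<n rewrite +-identityʳ x | +-identityʳ (V x) = below x+0<n
  shifted (suc k) {x} x+sk<n rewrite +-suc (V x) k = ≤-<-trans
    (+-monoˡ-≤ k (increasing (n<1+n x) (≤-<-trans (m≤m+n (suc x) k) sx+k<n))) (shifted k sx+k<n)
    where
    sx+k<n : suc x + k < n
    sx+k<n = subst (_< n) (+-suc x k) x+sk<n
  k : ℕ
  k = n ∸ suc x
  Vx+k<sx+k : V x + k < suc x + k
  Vx+k<sx+k = subst (V x + k <_) (sym (m+[n∸m]≡n x<n))
    (shifted k (subst (x + k <_) (m+[n∸m]≡n x<n) (n<1+n (x + k))))

decreasing⇒reverse : ∀ {n V} → MapsBelow n V → DecreasingBelow n V → AgreeBelow n V (reverseℕ n)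
decreasing⇒reverse {n} {V} below decreasing {x} x<n = begin
  V x                                ≡⟨ reverseℕ-involutive (below x<n) ⟨
  reverseℕ n (reverseℕ n (V x))      ≡⟨ cong (reverseℕ n) (increasing⇒identity W-below W-increasing x<n) ⟩
  reverseℕ n x                       ∎
  where
  open ≡-Reasoning
  W : ℕ → ℕ
  W = reverseℕ n ∘ V
  W-below : MapsBelow n W
  W-below y<n = reverseℕ-mapsBelow n (below y<n)
  W-increasing : IncreasingBelow n W
  W-increasing y<z z<n = reverseℕ-antitone (decreasing y<z z<n) (below (<-trans y<z z<n))

≤1⇒decreasingBelow : ∀ {n V} → n ≤ 1 → DecreasingBelow n V
≤1⇒decreasingBelow (s≤s z≤n) {y = suc _} _ (s≤s ())

EveryTriple : ℕ → (ℕ → ℕ → ℕ → Set) → Set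
EveryTriple n P = ∀ {x y z} → x < y → y < z → z < n → P x y z

MonotoneOn : (ℕ → ℕ → Set) → (ℕ → ℕ) → ℕ → ℕ → ℕ → Set
MonotoneOn _≺_ V x y z = (V x ≺ V y × V y ≺ V z) ⊎ (V y ≺ V x × V z ≺ V y)

monotone⇒ordered : ∀ {n V} {_≺_ : ℕ → ℕ → Set} → Transitive _≺_ → Asymmetric _≺_ →
  EveryTriple n (MonotoneOn _≺_ V) → V 0 ≺ V 1 → ∀ {x y} → x < y → y < n → V x ≺ V y
monotone⇒ordered {n} {V} {_≺_} ≺-trans ≺-asym monotone V₀≺V₁ = ordered
  where
  fromZero : ∀ {y} → 0 < y → y < n → V 0 ≺ V y
  fromZero {suc zero} _ _ = V₀≺V₁
  fromZero {suc (suc y)} _ y<n with monotone z<s (s<s z<s) y<n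
  ... | inj₁ (_ , V₁≺Vy) = ≺-trans V₀≺V₁ V₁≺Vy
  ... | inj₂ (V₁≺V₀ , _) = ⊥-elim (≺-asym V₀≺V₁ V₁≺V₀)
  ordered : ∀ {x y} → x < y → y < n → V x ≺ V y
  ordered {zero} 0<y y<n = fromZero 0<y y<n
  ordered {suc x} x<y y<n with monotone z<s x<y y<n
  ... | inj₁ (_ , Vx≺Vy) = Vx≺Vy
  ... | inj₂ (Vx≺V₀ , _) = ⊥-elim (≺-asym Vx≺V₀ (fromZero z<s (<-trans x<y y<n)))

monotone-classification : ∀ {n V} → MapsBelow n V → InjectiveBelow n V →
  EveryTriple n (MonotoneOn _<_ V) →
  AgreeBelow n V (λ x → x) ⊎ AgreeBelow n V (reverseℕ n)
monotone-classification {zero} below _ _ = inj₂ (decreasing⇒reverse below (≤1⇒decreasingBelow z≤n))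
monotone-classification {suc zero} below _ _ = inj₂ (decreasing⇒reverse below (≤1⇒decreasingBelow ≤-refl))
monotone-classification {suc (suc m)} {V} below injective monotone with <-cmp (V 0) (V 1)
... | tri< V₀<V₁ _ _ = inj₁ (increasing⇒identity below
      (monotone⇒ordered {V = V} {_≺_ = _<_} <-trans <-asym monotone V₀<V₁))
... | tri≈ _ V₀≡V₁ _ = ⊥-elim (0≢1+n (injective z<s (s<s z<s) V₀≡V₁))
... | tri> _ _ V₁<V₀ = inj₂ (decreasing⇒reverse below
      (monotone⇒ordered {V = V} {_≺_ = flip _<_} (flip <-trans) <-asym
        (λ x<y y<z z<n → swap (monotone x<y y<z z<n)) V₁<V₀))

-- The triple at x < y < z has shape 213 or 321.
OuterDescentOn : (ℕ → ℕ) → ℕ → ℕ → ℕ → Set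
OuterDescentOn V x y z = V y < V x × (V x < V z ⊎ V z < V y)

outerDescent-classification : ∀ {n V} → MapsBelow n V → InjectiveBelow n V →
  EveryTriple n (OuterDescentOn V) →
  AgreeBelow n V (reverseℕ n) ⊎ AgreeBelow n V (reverseInitℕ n)
outerDescent-classification {zero} below _ _ = inj₁ (decreasing⇒reverse below (≤1⇒decreasingBelow z≤n))
outerDescent-classification {suc zero} below _ _ = inj₁ (decreasing⇒reverse below (≤1⇒decreasingBelow ≤-refl))
outerDescent-classification {suc (suc m)} {V} below injective outerDescent with <-cmp (V 0) (V (suc m))
... | tri< V₀<Vₗ _ _ = inj₂ agree
  where
  last : ℕ
  last = suc m
  init : DecreasingBelow last V
  init x<y y<l = proj₁ (outerDescent x<y y<l ≤-refl)
  belowLast : ∀ {x} → x < last → V x < V last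
  belowLast {zero} _ = V₀<Vₗ
  belowLast {suc x} x<l = <-trans (init z<s x<l) V₀<Vₗ
  initReverse : AgreeBelow last V (reverseℕ last)
  initReverse = decreasing⇒reverse (λ x<l → <-≤-trans (belowLast x<l) (s≤s⁻¹ (below ≤-refl))) init
  lastFixed : V last ≡ last
  lastFixed = ≤-antisym (s≤s⁻¹ (below ≤-refl)) (subst (_< V last) (initReverse z<s) V₀<Vₗ)
  agree : AgreeBelow (suc last) V (reverseInitℕ (suc last))
  agree x<n with m<1+n⇒m<n∨m≡n x<n
  ... | inj₁ x<l = trans (initReverse x<l) (sym (reverseInitℕ-init (s≤s x<l)))
  ... | inj₂ refl = trans lastFixed (sym (reverseInitℕ-last (<-irrefl refl)))
... | tri≈ _ V₀≡Vₗ _ = ⊥-elim (0≢1+n (injective z<s ≤-refl V₀≡Vₗ))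
... | tri> _ _ Vₗ<V₀ = inj₁ (decreasing⇒reverse below decreasing)
  where
  last : ℕ
  last = suc m
  toLast : ∀ {x} → x < last → V last < V x
  toLast {zero} _ = Vₗ<V₀
  toLast {suc x} x<l with outerDescent z<s x<l ≤-refl
  ... | _ , inj₁ V₀<Vₗ = ⊥-elim (<-asym V₀<Vₗ Vₗ<V₀)
  ... | _ , inj₂ Vₗ<Vx = Vₗ<Vx
  decreasing : DecreasingBelow (suc last) V
  decreasing x<y y<n with m<1+n⇒m<n∨m≡n y<n
  ... | inj₁ y<l = proj₁ (outerDescent x<y y<l ≤-refl)
  ... | inj₂ refl = toLast x<y

module _ {n : ℕ} (σ : Perm n) where
  private
    V : ℕ → ℕ
    V = ⟦ σ ⟧
    distinct : ∀ {x y} → x < y → y < n → V x ≢ V y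
    distinct x<y y<n eq = <-irrefl (⟦⟧-injectiveBelow σ (<-trans x<y y<n) y<n eq) x<y

  avoids-τ₂⇒monotone : AvoidsAll σ τ₂ → EveryTriple n (MonotoneOn _<_ V)
  avoids-τ₂⇒monotone (a132 ∷ a213 ∷ a231 ∷ a312 ∷ []) {x} {y} {z} x<y y<z z<n
    with <-cmp (V x) (V y) | <-cmp (V y) (V z) | <-cmp (V x) (V z)
  ... | tri≈ _ eq _ | _ | _ = ⊥-elim (distinct x<y (<-trans y<z z<n) eq)
  ... | _ | tri≈ _ eq _ | _ = ⊥-elim (distinct y<z z<n eq)
  ... | _ | _ | tri≈ _ eq _ = ⊥-elim (distinct (<-trans x<y y<z) z<n eq)
  ... | tri< xy _ _ | tri< yz _ _ | _ = inj₁ (xy , yz)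
  ... | tri> _ _ yx | tri> _ _ zy | _ = inj₂ (yx , zy)
  ... | tri< xy _ _ | tri> _ _ zy | tri< xz _ _ =
    ⊥-elim (avoids⇒¬patternAt σ inverse132 a132 x<y y<z z<n (xz , zy))
  ... | tri< xy _ _ | tri> _ _ zy | tri> _ _ zx =
    ⊥-elim (avoids⇒¬patternAt σ inverse231 a231 x<y y<z z<n (zx , xy))
  ... | tri> _ _ yx | tri< yz _ _ | tri< xz _ _ =
    ⊥-elim (avoids⇒¬patternAt σ inverse213 a213 x<y y<z z<n (yx , xz))
  ... | tri> _ _ yx | tri< yz _ _ | tri> _ _ zx =
    ⊥-elim (avoids⇒¬patternAt σ inverse312 a312 x<y y<z z<n (yz , zx))

  avoids-τ₁⇒outerDescent : AvoidsAll σ τ₁ → EveryTriple n (OuterDescentOn V)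
  avoids-τ₁⇒outerDescent (a123 ∷ a132 ∷ a231 ∷ a312 ∷ []) {x} {y} {z} x<y y<z z<n
    with <-cmp (V x) (V y) | <-cmp (V y) (V z) | <-cmp (V x) (V z)
  ... | tri≈ _ eq _ | _ | _ = ⊥-elim (distinct x<y (<-trans y<z z<n) eq)
  ... | _ | tri≈ _ eq _ | _ = ⊥-elim (distinct y<z z<n eq)
  ... | _ | _ | tri≈ _ eq _ = ⊥-elim (distinct (<-trans x<y y<z) z<n eq)
  ... | tri< xy _ _ | tri< yz _ _ | _ =
    ⊥-elim (avoids⇒¬patternAt σ inverse123 a123 x<y y<z z<n (xy , yz))
  ... | tri< xy _ _ | tri> _ _ zy | tri< xz _ _ =
    ⊥-elim (avoids⇒¬patternAt σ inverse132 a132 x<y y<z z<n (xz , zy))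
  ... | tri< xy _ _ | tri> _ _ zy | tri> _ _ zx =
    ⊥-elim (avoids⇒¬patternAt σ inverse231 a231 x<y y<z z<n (zx , xy))
  ... | tri> _ _ yx | _ | tri< xz _ _ = yx , inj₁ xz
  ... | tri> _ _ yx | tri< yz _ _ | tri> _ _ zx =
    ⊥-elim (avoids⇒¬patternAt σ inverse312 a312 x<y y<z z<n (yz , zx))
  ... | tri> _ _ yx | tri> _ _ zy | tri> _ _ _ = yx , inj₂ zy

τ₁-avoider-classification : ∀ {n} (σ : Perm n) → AvoidsAll σ τ₁ →
  AgreeBelow n ⟦ σ ⟧ (reverseℕ n) ⊎ AgreeBelow n ⟦ σ ⟧ (reverseInitℕ n)
τ₁-avoider-classification σ avoids =
  outerDescent-classification (⟦⟧-mapsBelow σ) (⟦⟧-injectiveBelow σ) (avoids-τ₁⇒outerDescent σ avoids)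

τ₂-avoider-classification : ∀ {n} (σ : Perm n) → AvoidsAll σ τ₂ →
  AgreeBelow n ⟦ σ ⟧ (reverseℕ n) ⊎ AgreeBelow n ⟦ σ ⟧ (λ x → x)
τ₂-avoider-classification σ avoids =
  swap (monotone-classification (⟦⟧-mapsBelow σ) (⟦⟧-injectiveBelow σ) (avoids-τ₂⇒monotone σ avoids))

-- Corners of permutation matrices

entry : (C : ℕ) → ℕ → Maybe (Fin C)
entry C v with v <? C
... | yes v<C = just (fromℕ< v<C)
... | no _ = nothing

entry-< : ∀ {C v} (v<C : v < C) → entry C v ≡ just (fromℕ< v<C)
entry-< {C} {v} v<C with v <? C
... | yes _ = refl
... | no v≮C = ⊥-elim (v≮C v<C)

entry-≮ : ∀ {C v} → ¬ v < C → entry C v ≡ nothing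
entry-≮ {C} {v} v≮C with v <? C
... | yes v<C = ⊥-elim (v≮C v<C)
... | no _ = refl

entry≡just⇔ : ∀ {C v} {j : Fin C} → (entry C v ≡ just j) ⇔ (toℕ j ≡ v)
entry≡just⇔ {C} {v} {j} = mk⇔ to from
  where
  to : entry C v ≡ just j → toℕ j ≡ v
  to eq with v <? C
  to refl | yes v<C = toℕ-fromℕ< v<C
  to () | no _
  from : toℕ j ≡ v → entry C v ≡ just j
  from refl = trans (entry-< (toℕ<n j)) (cong just (fromℕ<-toℕ j (toℕ<n j)))

corner : (R C : ℕ) → (ℕ → ℕ) → PMat R C
corner R C h = tabulate (entry C ∘ h ∘ toℕ)

lookup-corner : ∀ {R C} h (i : Fin R) → lookup (corner R C h) i ≡ entry C (h (toℕ i))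
lookup-corner h = lookup∘tabulate _

corner-cong : ∀ {R C g h} → AgreeBelow R g h → corner R C g ≡ corner R C h
corner-cong g≗h = tabulate-cong (λ i → cong (entry _) (g≗h (toℕ<n i)))

corner-agreeOnDots : ∀ {R C} g h → corner R C g ≡ corner R C h →
  ∀ {x} → x < R → h x < C → g x ≡ h x
corner-agreeOnDots {R} {C} g h eq {x} x<R hx<C =
  trans (sym (Equivalence.to entry≡just⇔ gx-entry)) (toℕ-fromℕ< hx<C)
  where
  open ≡-Reasoning
  i : Fin R
  i = fromℕ< x<R
  lookup-at : ∀ f → lookup (corner R C f) i ≡ entry C (f x)
  lookup-at f = trans (lookup-corner f i) (cong (entry C ∘ f) (toℕ-fromℕ< x<R))
  gx-entry : entry C (g x) ≡ just (fromℕ< hx<C)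
  gx-entry = begin
    entry C (g x)          ≡⟨ lookup-at g ⟨
    lookup (corner R C g) i ≡⟨ cong (λ ρ → lookup ρ i) eq ⟩
    lookup (corner R C h) i ≡⟨ lookup-at h ⟩
    entry C (h x)          ≡⟨ entry-< hx<C ⟩
    just (fromℕ< hx<C)     ∎

corner-colInjective : ∀ {R C n} → R ≤ n → (σ : Perm n) → ColInjective (corner R C ⟦ σ ⟧)
corner-colInjective R≤n σ i i' j eq eq' = toℕ-injective (⟦⟧-injectiveBelow σ
  (<-≤-trans (toℕ<n i) R≤n) (<-≤-trans (toℕ<n i') R≤n)
  (trans (sym (column i eq)) (column i' eq')))
  where
  column : ∀ i → lookup (corner _ _ ⟦ σ ⟧) i ≡ just j → toℕ j ≡ ⟦ σ ⟧ (toℕ i)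
  column i eq = Equivalence.to entry≡just⇔ (trans (sym (lookup-corner ⟦ σ ⟧ i)) eq)

PMat-≟ : ∀ {R C} → DecidableEquality (PMat R C)
PMat-≟ = Vec.≡-dec (Maybe.≡-dec Fin._≟_)

PMat-columnless : ∀ {R} (ρ ρ' : PMat R 0) → ρ ≡ ρ'
PMat-columnless [] [] = refl
PMat-columnless (nothing ∷ ρ) (nothing ∷ ρ') = cong (nothing ∷_) (PMat-columnless ρ ρ')

module _ (d c r : ℕ) where

  rows≤size : d + r ≤ d + c + r
  rows≤size = +-monoˡ-≤ r (m≤m+n d c)

  cols≤size : d + c ≤ d + c + r
  cols≤size = m≤m+n (d + c) r

  corner-cong-size : ∀ {g h} → AgreeBelow (d + c + r) g h → corner (d + r) (d + c) g ≡ corner (d + r) (d + c) h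
  corner-cong-size g≗h = corner-cong λ x<R → g≗h (<-≤-trans x<R rows≤size)

  corner-extends : (σ : Perm (d + c + r)) → Extends d c r σ (corner (d + r) (d + c) ⟦ σ ⟧)
  corner-extends σ i j i' j' i≡i' j≡j' = mk⇔ to from
    where
    value : ⟦ σ ⟧ (toℕ i) ≡ toℕ (fun σ i')
    value = trans (cong ⟦ σ ⟧ i≡i') (⟦⟧-toℕ σ i')
    dot⇔ : (lookup (corner _ _ ⟦ σ ⟧) i ≡ just j) ⇔ (toℕ j ≡ ⟦ σ ⟧ (toℕ i))
    dot⇔ = subst (λ e → (e ≡ just j) ⇔ (toℕ j ≡ ⟦ σ ⟧ (toℕ i))) (sym (lookup-corner ⟦ σ ⟧ i))
      entry≡just⇔
    to : lookup (corner _ _ ⟦ σ ⟧) i ≡ just j → fun σ i' ≡ j'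
    to eq = toℕ-injective (trans (sym value) (trans (sym (Equivalence.to dot⇔ eq)) j≡j'))
    from : fun σ i' ≡ j' → lookup (corner _ _ ⟦ σ ⟧) i ≡ just j
    from refl = Equivalence.from dot⇔ (trans j≡j' (sym value))

  extends⇒corner : (σ : Perm (d + c + r)) (ρ : PMat (d + r) (d + c)) → Extends d c r σ ρ →
    ρ ≡ corner (d + r) (d + c) ⟦ σ ⟧
  extends⇒corner σ ρ extends = trans (sym (tabulate∘lookup ρ)) (tabulate-cong row)
    where
    open ≡-Reasoning
    row↑ : Fin (d + r) → Fin (d + c + r)
    row↑ i = inject≤ i rows≤size
    value : ∀ i → ⟦ σ ⟧ (toℕ i) ≡ toℕ (fun σ (row↑ i))
    value i = trans (cong ⟦ σ ⟧ (sym (toℕ-inject≤ i rows≤size))) (⟦⟧-toℕ σ (row↑ i))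
    extends-at : ∀ i (j : Fin (d + c)) j' → toℕ j ≡ toℕ j' →
      (lookup ρ i ≡ just j) ⇔ (fun σ (row↑ i) ≡ j')
    extends-at i j j' = extends i j (row↑ i) j' (sym (toℕ-inject≤ i rows≤size))
    row : ∀ i → lookup ρ i ≡ entry (d + c) (⟦ σ ⟧ (toℕ i))
    row i with lookup ρ i in eq
    ... | just j = sym (Equivalence.from entry≡just⇔ (begin
      toℕ j                      ≡⟨ toℕ-inject≤ j cols≤size ⟨
      toℕ (inject≤ j cols≤size)
        ≡⟨ cong toℕ (Equivalence.to (extends-at i j _ (sym (toℕ-inject≤ j _))) eq) ⟨
      toℕ (fun σ (row↑ i))        ≡⟨ value i ⟨
      ⟦ σ ⟧ (toℕ i)               ∎))
    ... | nothing = sym (noDot (⟦ σ ⟧ (toℕ i) <? d + c))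
      where
      noDot : Dec (⟦ σ ⟧ (toℕ i) < d + c) → entry (d + c) (⟦ σ ⟧ (toℕ i)) ≡ nothing
      noDot (no v≮C) = entry-≮ v≮C
      noDot (yes v<C) with () ← trans (sym eq)
        (Equivalence.from (extends-at i (fromℕ< v<C) (fun σ (row↑ i)) (trans (toℕ-fromℕ< v<C) (value i))) refl)

module _ {C : ℕ} where

  dots-corner-hit : ∀ R h → h 0 < C → dots (corner (suc R) C h) ≡ suc (dots (corner R C (h ∘ suc)))
  dots-corner-hit R h h₀<C = cong (λ e → dots (e ∷ corner R C (h ∘ suc))) (entry-< h₀<C)

  dots-corner-miss : ∀ R h → ¬ h 0 < C → dots (corner (suc R) C h) ≡ dots (corner R C (h ∘ suc))
  dots-corner-miss R h h₀≮C = cong (λ e → dots (e ∷ corner R C (h ∘ suc))) (entry-≮ h₀≮C)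

  dots-corner-tail : ∀ R h → dots (corner R C (h ∘ suc)) ≤ dots (corner (suc R) C h)
  dots-corner-tail R h = byHead (h 0 <? C)
    where
    byHead : Dec (h 0 < C) → dots (corner R C (h ∘ suc)) ≤ dots (corner (suc R) C h)
    byHead (yes h₀<C) = ≤-trans (n≤1+n _) (≤-reflexive (sym (dots-corner-hit R h h₀<C)))
    byHead (no h₀≮C) = ≤-reflexive (sym (dots-corner-miss R h h₀≮C))

  dots-corner-interval : ∀ R h {lo hi} → lo ≤ hi → hi ≤ R →
    (∀ {x} → lo ≤ x → x < hi → h x < C) → (∀ {x} → x < R → h x < C → lo ≤ x × x < hi) →
    dots (corner R C h) ≡ hi ∸ lo
  dots-corner-interval zero h z≤n z≤n inside outside = refl
  dots-corner-interval (suc R) h {zero} {zero} _ _ inside outside =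
    trans (dots-corner-miss R h (λ h₀<C → n≮0 (proj₂ (outside z<s h₀<C))))
      (dots-corner-interval R (h ∘ suc) z≤n z≤n (λ _ ())
        (λ x<R hx<C → ⊥-elim (n≮0 (proj₂ (outside (s≤s x<R) hx<C)))))
  dots-corner-interval (suc R) h {zero} {suc hi} _ (s≤s hi≤R) inside outside =
    trans (dots-corner-hit R h (inside z≤n z<s))
      (cong suc (dots-corner-interval R (h ∘ suc) z≤n hi≤R (λ _ x<hi → inside z≤n (s≤s x<hi))
        (λ x<R hx<C → z≤n , s≤s⁻¹ (proj₂ (outside (s≤s x<R) hx<C)))))
  dots-corner-interval (suc R) h {suc lo} {suc hi} (s≤s lo≤hi) (s≤s hi≤R) inside outside =
    trans (dots-corner-miss R h (λ h₀<C → n≮0 (proj₁ (outside z<s h₀<C))))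
      (dots-corner-interval R (h ∘ suc) lo≤hi hi≤R (λ lo≤x x<hi → inside (s≤s lo≤x) (s≤s x<hi))
        (λ x<R hx<C → let lo≤sx , sx<shi = outside (s≤s x<R) hx<C in s≤s⁻¹ lo≤sx , s≤s⁻¹ sx<shi))

  dots-corner-≥ : ∀ R h {lo hi} → hi ≤ R → (∀ {x} → lo ≤ x → x < hi → h x < C) →
    hi ∸ lo ≤ dots (corner R C h)
  dots-corner-≥ R h {lo} {zero} _ _ = ≤-trans (≤-reflexive (0∸n≡0 lo)) z≤n
  dots-corner-≥ (suc R) h {zero} {suc hi} (s≤s hi≤R) inside =
    ≤-trans (s≤s (dots-corner-≥ R (h ∘ suc) {0} hi≤R (λ _ x<hi → inside z≤n (s≤s x<hi))))
      (≤-reflexive (sym (dots-corner-hit R h (inside z≤n z<s))))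
  dots-corner-≥ (suc R) h {suc lo} {suc hi} (s≤s hi≤R) inside =
    ≤-trans (dots-corner-≥ R (h ∘ suc) hi≤R (λ lo≤x x<hi → inside (s≤s lo≤x) (s≤s x<hi)))
      (dots-corner-tail R h)

Thin : ℕ → ℕ → Set
Thin c r = r ≡ 0 ⊎ c ≡ 0

thin⇔⊓≡0 : ∀ c r → Thin c r ⇔ (r ⊓ c ≡ 0)
thin⇔⊓≡0 c r = mk⇔ (to c r) (from c r)
  where
  to : ∀ c r → Thin c r → r ⊓ c ≡ 0
  to c r (inj₁ refl) = refl
  to c r (inj₂ refl) = ⊓-zeroʳ r
  from : ∀ c r → r ⊓ c ≡ 0 → Thin c r
  from c zero _ = inj₁ refl
  from zero (suc r) _ = inj₂ refl

dots-corner-identity : ∀ R C → dots (corner R C (λ x → x)) ≡ R ⊓ C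
dots-corner-identity R C = dots-corner-interval R (λ x → x) z≤n (m⊓n≤m R C)
  (λ _ x<R⊓C → <-≤-trans x<R⊓C (m⊓n≤n R C)) (λ x<R x<C → z≤n , ⊓-pres-m< x<R x<C)

module _ (d c r : ℕ) where

  dots-corner-reversal : dots (corner (d + r) (d + c) (reverseℕ (d + c + r))) ≡ d
  dots-corner-reversal =
    trans (dots-corner-interval (d + r) _ (m≤n+m r d) ≤-refl inside outside) (m+n∸n≡m d r)
    where
    rev<⇔ : ∀ {x} → x < d + r → (reverseℕ (d + c + r) x < d + c) ⇔ (r ≤ x)
    rev<⇔ x<R = reverseℕ-<⇔ (d + c) r (<-≤-trans x<R (rows≤size d c r))
    inside : ∀ {x} → r ≤ x → x < d + r → reverseℕ (d + c + r) x < d + c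
    inside r≤x x<R = Equivalence.from (rev<⇔ x<R) r≤x
    outside : ∀ {x} → x < d + r → reverseℕ (d + c + r) x < d + c → r ≤ x × x < d + r
    outside x<R rev<C = Equivalence.to (rev<⇔ x<R) rev<C , x<R

  dots-corner-identity≡⇔thin : (dots (corner (d + r) (d + c) (λ x → x)) ≡ d) ⇔ Thin c r
  dots-corner-identity≡⇔thin = mk⇔
    (λ eq → Equivalence.from (thin⇔⊓≡0 c r)
      (+-cancelˡ-≡ d (r ⊓ c) 0 (trans (sym identity-dots) (trans eq (sym (+-identityʳ d))))))
    (λ thin → trans identity-dots (trans (cong (d +_) (Equivalence.to (thin⇔⊓≡0 c r) thin)) (+-identityʳ d)))
    where
    identity-dots : dots (corner (d + r) (d + c) (λ x → x)) ≡ d + r ⊓ c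
    identity-dots = trans (dots-corner-identity (d + r) (d + c)) (sym (+-distribˡ-⊓ d r c))

dots-corner-reverseInit-noEmptyRows : ∀ d c → dots (corner (d + 0) (d + c) (reverseInitℕ (d + c + 0))) ≡ d
dots-corner-reverseInit-noEmptyRows d c =
  trans (dots-corner-interval (d + 0) _ z≤n ≤-refl inside (λ x<R _ → z≤n , x<R)) (+-identityʳ d)
  where
  inside : ∀ {x} → 0 ≤ x → x < d + 0 → reverseInitℕ (d + c + 0) x < d + c
  inside {x} _ x<R = subst (reverseInitℕ (d + c + 0) x <_) (+-identityʳ (d + c))
    (reverseInitℕ-mapsBelow (d + c + 0) (<-≤-trans x<R (rows≤size d c 0)))

dots-corner-reverseInit-noEmptyCols : ∀ d r →
  dots (corner (d + suc r) (d + 0) (reverseInitℕ (d + 0 + suc r))) ≡ d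
dots-corner-reverseInit-noEmptyCols d r =
  trans (dots-corner-interval (d + suc r) _ (m≤n+m r C) hi≤R inside outside)
    (trans (m+n∸n≡m C r) (+-identityʳ d))
  where
  C : ℕ
  C = d + 0
  hi≤R : C + r ≤ d + suc r
  hi≤R = ≤-trans (≤-reflexive (cong (_+ r) (+-identityʳ d))) (+-monoʳ-≤ d (n≤1+n r))
  inside : ∀ {x} → r ≤ x → x < C + r → reverseInitℕ (C + suc r) x < C
  inside r≤x x<hi = Equivalence.from (reverseInitℕ-<⇔ C r x<hi) r≤x
  outside : ∀ {x} → x < d + suc r → reverseInitℕ (C + suc r) x < C → r ≤ x × x < C + r
  outside {x} _ v<C with x <? C + r
  ... | yes x<hi = Equivalence.to (reverseInitℕ-<⇔ C r x<hi) v<C , x<hi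
  ... | no x≮hi =
    ⊥-elim (≤⇒≯ (≤-trans (m≤m+n C r) (≮⇒≥ x≮hi)) (subst (_< C) (reverseInitℕ-last last) v<C))
    where
    last : ¬ suc x < C + suc r
    last sx<N = x≮hi (s≤s⁻¹ (subst (suc x <_) (+-suc C r) sx<N))

d<dots-corner-reverseInit : ∀ d c r →
  suc d ≤ dots (corner (d + suc r) (d + suc c) (reverseInitℕ (d + suc c + suc r)))
d<dots-corner-reverseInit d c r =
  subst (_≤ dots (corner (d + suc r) (d + suc c) (reverseInitℕ (d + suc c + suc r)))) (m+n∸n≡m (suc d) r)
    (dots-corner-≥ (d + suc r) _ (≤-reflexive (sym (+-suc d r))) inside)
  where
  inside : ∀ {x} → r ≤ x → x < suc (d + r) → reverseInitℕ (d + suc c + suc r) x < d + suc c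
  inside r≤x x<hi = Equivalence.from
    (reverseInitℕ-<⇔ (d + suc c) r (≤-<-trans (s≤s⁻¹ x<hi) (+-monoˡ-< r (m<m+n d z<s)))) r≤x

dots-corner-reverseInit≡⇔thin : ∀ d c r →
  (dots (corner (d + r) (d + c) (reverseInitℕ (d + c + r))) ≡ d) ⇔ Thin c r
dots-corner-reverseInit≡⇔thin d c r = mk⇔ (to c r) (from c r)
  where
  to : ∀ c r → dots (corner (d + r) (d + c) (reverseInitℕ (d + c + r))) ≡ d → Thin c r
  to c zero _ = inj₁ refl
  to zero (suc r) _ = inj₂ refl
  to (suc c) (suc r) eq = ⊥-elim (1+n≰n (subst (suc d ≤_) eq (d<dots-corner-reverseInit d c r)))
  from : ∀ c r → Thin c r → dots (corner (d + r) (d + c) (reverseInitℕ (d + c + r))) ≡ d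
  from c zero _ = dots-corner-reverseInit-noEmptyRows d c
  from zero (suc r) _ = dots-corner-reverseInit-noEmptyCols d r
  from (suc c) (suc r) (inj₁ ())
  from (suc c) (suc r) (inj₂ ())

-- Exactly when this holds, both sets have an element besides the corner of the reversal.
Separated : ℕ → ℕ → ℕ → Set
Separated d c r = Thin c r × 0 < d × 1 < d + c + r

SeparatingRow : ℕ → ℕ → ℕ → (ℕ → ℕ) → Set
SeparatingRow d c r h = ∃ λ x → x < d + r × h x < d + c × reverseℕ (d + c + r) x ≢ h x

identity-separatingRow : ∀ d c r → Separated d c r → SeparatingRow d c r (λ x → x)
identity-separatingRow d c r (_ , 0<d , 1<N) =
  0 , ≤-trans 0<d (m≤m+n d r) , ≤-trans 0<d (m≤m+n d c) , m>n⇒m∸n≢0 1<N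

reverseInit-separatingRow : ∀ d c r → Separated d c r → SeparatingRow d c r (reverseInitℕ (d + c + r))
reverseInit-separatingRow d c zero (_ , 0<d , 1<N) =
  0 , ≤-trans 0<d (m≤m+n d 0) ,
  subst (reverseInitℕ (d + c + 0) 0 <_) (+-identityʳ (d + c))
    (reverseInitℕ-mapsBelow (d + c + 0) (<-trans z<s 1<N)) ,
  (λ eq → <-irrefl (sym eq) (reverseInitℕ<reverseℕ 1<N))
reverseInit-separatingRow d zero (suc r) (_ , 0<d , _) =
  r , r<R , Equivalence.from (reverseInitℕ-<⇔ (d + 0) r r<d+0+r) ≤-refl ,
  (λ eq → <-irrefl (sym eq) (reverseInitℕ<reverseℕ sr<N))
  where
  r<R : r < d + suc r
  r<R = subst (r <_) (sym (+-suc d r)) (s≤s (m≤n+m r d))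
  r<d+0+r : r < d + 0 + r
  r<d+0+r = +-monoˡ-< r (subst (0 <_) (sym (+-identityʳ d)) 0<d)
  sr<N : suc r < d + 0 + suc r
  sr<N = subst (suc r <_) (sym (+-suc (d + 0) r)) (s≤s r<d+0+r)
reverseInit-separatingRow d (suc c) (suc r) (inj₁ () , _)
reverseInit-separatingRow d (suc c) (suc r) (inj₂ () , _)

dotless-thin-unique : ∀ c r → Thin c r → (ρ ρ' : PMat (0 + r) (0 + c)) → ρ ≡ ρ'
dotless-thin-unique c zero _ [] [] = refl
dotless-thin-unique zero (suc r) _ ρ ρ' = PMat-columnless ρ ρ'
dotless-thin-unique (suc c) (suc r) (inj₁ ())
dotless-thin-unique (suc c) (suc r) (inj₂ ())

hasSize-pair : {X : Set} → DecidableEquality X → {P : X → Set} {a b : X} → P a →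
  (∀ x → P x → x ≡ a ⊎ x ≡ b) → (D : Dec (P b × a ≢ b)) → HasSize P (if does D then 2 else 1)
hasSize-pair _≟_ {P} {a} {b} pa cases (yes (pb , a≢b)) =
  a ∷ b ∷ [] , refl , (a≢b ∷ []) ∷ [] ∷ [] , pa ∷ pb ∷ [] , λ x px → listed (cases x px)
  where
  listed : ∀ {x} → x ≡ a ⊎ x ≡ b → x ∈ a ∷ b ∷ []
  listed (inj₁ x≡a) = here x≡a
  listed (inj₂ x≡b) = there (here x≡b)
hasSize-pair _≟_ {P} {a} {b} pa cases (no ¬pb×a≢b) =
  a ∷ [] , refl , [] ∷ [] , pa ∷ [] , λ x px → here (onlyA px (cases x px))
  where
  onlyA : ∀ {x} → P x → x ≡ a ⊎ x ≡ b → x ≡ a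
  onlyA _ (inj₁ x≡a) = x≡a
  onlyA {x} px (inj₂ x≡b) with a ≟ b
  ... | yes a≡b = trans x≡b (sym a≡b)
  ... | no a≢b = ⊥-elim (¬pb×a≢b (subst P x≡b px , a≢b))

distinct⇔separated : ∀ d c r {h} → MapsBelow (d + c + r) h →
  (dots (corner (d + r) (d + c) h) ≡ d ⇔ Thin c r) → (Separated d c r → SeparatingRow d c r h) →
  (dots (corner (d + r) (d + c) h) ≡ d ×
    corner (d + r) (d + c) (reverseℕ (d + c + r)) ≢ corner (d + r) (d + c) h)
    ⇔ Separated d c r
distinct⇔separated d c r {h} h-below dots⇔thin separating = mk⇔ to from
  where
  R C N : ℕ
  R = d + r
  C = d + c
  N = d + c + r
  to : dots (corner R C h) ≡ d × corner R C (reverseℕ N) ≢ corner R C h → Separated d c r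
  to (dots≡d , distinct) = thin , n≢0⇒n>0 dotted , ≰⇒> tiny⇒equal
    where
    thin : Thin c r
    thin = Equivalence.to dots⇔thin dots≡d
    dotted : d ≢ 0
    dotted refl = distinct (dotless-thin-unique c r thin _ _)
    tiny⇒equal : ¬ N ≤ 1
    tiny⇒equal N≤1 = distinct (corner-cong-size d c r (≤1⇒agreeBelow N≤1 (reverseℕ-mapsBelow N) h-below))
  from : Separated d c r → dots (corner R C h) ≡ d × corner R C (reverseℕ N) ≢ corner R C h
  from separated@(thin , _) with separating separated
  ... | x , x<R , hx<C , rev≢h = Equivalence.from dots⇔thin thin ,
    λ eq → rev≢h (corner-agreeOnDots (reverseℕ N) h eq x<R hx<C)

module _ (d c r : ℕ) {τ : List Pattern} where
  private
    R C N : ℕ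
    R = d + r
    C = d + c
    N = d + c + r

  corner-∈S : (σ : Perm N) {h : ℕ → ℕ} → AvoidsAll σ τ → AgreeBelow N ⟦ σ ⟧ h →
    dots (corner R C h) ≡ d → InS τ d c r (corner R C h)
  corner-∈S σ {h} avoids agree dots≡d = subst (InS τ d c r) σ-corner
    ((corner-colInjective (rows≤size d c r) σ , trans (cong dots σ-corner) dots≡d) ,
      σ , corner-extends d c r σ , avoids)
    where
    σ-corner : corner R C ⟦ σ ⟧ ≡ corner R C h
    σ-corner = corner-cong-size d c r agree

  ∈S⇒corner : ∀ {ρ} → InS τ d c r ρ →
    ∃ λ (σ : Perm N) → AvoidsAll σ τ × ρ ≡ corner R C ⟦ σ ⟧
  ∈S⇒corner (_ , σ , extends , avoids) = σ , avoids , extends⇒corner d c r σ _ extends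

  ∈S-candidates : ∀ {g h} →
    (∀ (σ : Perm N) → AvoidsAll σ τ → AgreeBelow N ⟦ σ ⟧ g ⊎ AgreeBelow N ⟦ σ ⟧ h) →
    ∀ ρ → InS τ d c r ρ → ρ ≡ corner R C g ⊎ ρ ≡ corner R C h
  ∈S-candidates classify ρ ρ∈S with ∈S⇒corner ρ∈S
  ... | σ , avoids , ρ≡ = Sum.map (trans ρ≡ ∘ corner-cong-size d c r) (trans ρ≡ ∘ corner-cong-size d c r)
    (classify σ avoids)

  separated⇔second-candidate : (σ : Perm N) {h : ℕ → ℕ} → AvoidsAll σ τ → AgreeBelow N ⟦ σ ⟧ h →
    (dots (corner R C h) ≡ d ⇔ Thin c r) → (Separated d c r → SeparatingRow d c r h) →
    Separated d c r ⇔ (InS τ d c r (corner R C h) × corner R C (reverseℕ N) ≢ corner R C h)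
  separated⇔second-candidate σ {h} avoids agree dots⇔thin separating = mk⇔
    (λ separated → let dots≡d , distinct = Equivalence.from separation separated in
      corner-∈S σ avoids agree dots≡d , distinct)
    (λ (h∈S , distinct) → Equivalence.to separation (proj₂ (proj₁ h∈S) , distinct))
    where
    h-below : MapsBelow N h
    h-below x<N = subst (_< N) (agree x<N) (⟦⟧-mapsBelow σ x<N)
    separation : (dots (corner R C h) ≡ d × corner R C (reverseℕ N) ≢ corner R C h) ⇔ Separated d c r
    separation = distinct⇔separated d c r h-below dots⇔thin separating

proposition5p4 : ∀ (d c r : ℕ) → ∃ λ k →
    HasSize (InS (p123 ∷ p132 ∷ p231 ∷ p312 ∷ []) d c r) k ×
    HasSize (InS (p132 ∷ p213 ∷ p231 ∷ p312 ∷ []) d c r) k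
proposition5p4 d c r = (if does separated? then 2 else 1) ,
  hasSize-pair PMat-≟ (reversal∈S (reversal-avoids-τ₁ N)) (∈S-candidates d c r τ₁-avoider-classification)
    (Dec.map second₁ separated?) ,
  hasSize-pair PMat-≟ (reversal∈S (reversal-avoids-τ₂ N)) (∈S-candidates d c r τ₂-avoider-classification)
    (Dec.map second₂ separated?)
  where
  N : ℕ
  N = d + c + r
  separated? : Dec (Separated d c r)
  separated? = ((r ≟ 0) ⊎-dec (c ≟ 0)) ×-dec (0 <? d) ×-dec (1 <? N)
  reversal∈S : ∀ {τ} → AvoidsAll (reversal N) τ → InS τ d c r (corner (d + r) (d + c) (reverseℕ N))
  reversal∈S avoids = corner-∈S d c r (reversal N) avoids (⟦reversal⟧ N) (dots-corner-reversal d c r)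
  second₁ : Separated d c r ⇔ (InS τ₁ d c r (corner (d + r) (d + c) (reverseInitℕ N)) ×
    corner (d + r) (d + c) (reverseℕ N) ≢ corner (d + r) (d + c) (reverseInitℕ N))
  second₁ = separated⇔second-candidate d c r (reverseInit N) (reverseInit-avoids-τ₁ N) (⟦reverseInit⟧ N)
    (dots-corner-reverseInit≡⇔thin d c r) (reverseInit-separatingRow d c r)
  second₂ : Separated d c r ⇔ (InS τ₂ d c r (corner (d + r) (d + c) (λ x → x)) ×
    corner (d + r) (d + c) (reverseℕ N) ≢ corner (d + r) (d + c) (λ x → x))
  second₂ = separated⇔second-candidate d c r (identity N) (identity-avoids-τ₂ N) (⟦identity⟧ N)
    (dots-corner-identity≡⇔thin d c r) (identity-separatingRow d c r)
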